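{- Let $n\ge2$ be an integer and let $S=\{s_1<s_2<\cdots\}$ be an infinite subset of $\mathbb{N}$, enumerated increasingly. If $\sum_{i=1}^n s_{k_i}\notin S$ for all $1\le k_1<\cdots<k_n$, then $\mathbb{N}\setminus S$ is an IP$_n$*-set in $\mathbb{N}$.
   Context: $\mathbb{N}=\{1,2,\dots\}$. For $x_1,\dots,x_n\in\mathbb{N}$, $FS((x_t)_{t=1}^n)=\{\sum_{t\in\alpha}x_t:\emptyset\ne\alpha\subset\{1,\dots,n\}\}$. For $n\ge2$, $A\subset\mathbb{N}$ is an IP$_n$-set if whenever $\mathcal{F}$ is a finite partition of $A$, there exist $F\in\mathcal{F}$ and $x_1,\dots,x_n\in\mathbb{N}$ with $FS((x_t)_{t=1}^n)\subset F$. $B$ is an IP$_n$*-set if $B\cap A\ne\emptyset$ for every IP$_n$-set $A$. -}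

module Defs where

open import Data.Nat using (ℕ; zero; suc; _+_; _<_; _≤_)
open import Data.Fin using (Fin; zero; suc)
open import Data.Fin.Subset using (Subset; Side; inside; outside; Nonempty)
open import Data.Vec using ([]; _∷_)
open import Data.Product using (Σ; ∃; _×_; _,_)
open import Data.Empty using (⊥)
open import Relation.Nullary using (¬_)
open import Relation.Binary.PropositionalEquality using (_≡_)

-- Subsets of ℕ (= {0,1,2,...}) are predicates; subsets of the paper's
-- 𝐍 = {1,2,...} are predicates P with P x → 1 ≤ x.
Pred : Set₁
Pred = ℕ → Set

finSum : ∀ {n} → (Fin n → ℕ) → ℕ
finSum {zero} f = 0
finSum {suc n} f = f zero + finSum (λ i → f (suc i))

subsetSum : ∀ {n} → Subset n → (Fin n → ℕ) → ℕ
subsetSum [] x = 0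
subsetSum (inside ∷ α) x = x zero + subsetSum α (λ i → x (suc i))
subsetSum (outside ∷ α) x = subsetSum α (λ i → x (suc i))

FS⊆ : ∀ {n} → (Fin n → ℕ) → (ℕ → Set) → Set
FS⊆ {n} x F = (α : Subset n) → Nonempty α → F (subsetSum α x)

-- A is an IP_n-set: for every finite partition of A (given as a colouring
-- c : A → Fin r, cells = colour classes) some cell F contains FS((x_t)) for
-- some x_1..x_n ∈ 𝐍.
IP : ℕ → Pred → Set
IP n A = (r : ℕ) (c : (y : ℕ) → A y → Fin r) →
  Σ (Fin r) λ j → Σ (Fin n → ℕ) λ x →
    ((t : Fin n) → 1 ≤ x t) ×
    FS⊆ x (λ y → Σ (A y) λ a → c y a ≡ j)

IP* : ℕ → Pred → Set₁
IP* n B = (A : Pred) → (∀ y → A y → 1 ≤ y) → IP n A →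
  ¬ (∀ y → B y → A y → ⊥)

StrictlyIncreasing : ∀ {m} → (Fin m → ℕ) → Set
StrictlyIncreasing {m} k = (i j : Fin m) → Data.Fin._<_ i j → k i < k j

Range : (ℕ → ℕ) → Pred
Range s y = ∃ λ k → s k ≡ y

Compl : Pred → Pred
Compl S y = (1 ≤ y) × ¬ S y

{-# OPTIONS --safe #-}
module Submission where

-- Suppose an IP_n-set A ⊆ 𝐍 misses 𝐍 ∖ S, so that A ⊆ S (up to double
-- negation, which is enough as the goal is a negation). Colour A by the parity
-- of ⌊log₂ y⌋. Doubling flips this colour, so in a monochromatic FS((x_t)) the
-- x_t are pairwise distinct: otherwise x_a and x_a + x_b = 2 x_a would share a
-- cell. Hence x_1, …, x_n are distinct elements s_{k_1}, …, s_{k_n} of S;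
-- sorting the indices makes them strictly increasing, and then
-- Σ s_{k_t} = Σ x_t ∈ FS((x_t)) ⊆ S contradicts the hypothesis.

open import Defs
open import Data.Nat using (ℕ; _<_; _≤_)
open import Data.Fin using (Fin)
open import Relation.Nullary using (¬_)

open import Data.Nat.Base using (zero; suc; _+_; _*_; s≤s; >-nonZero)
open import Data.Nat.Properties
  using (≤-refl; ≤-trans; <⇒≤; ≰⇒>; _≤?_; ≤∧≢⇒<; +-comm; +-identityʳ; +-0-commutativeMonoid)
open import Data.Nat.Logarithm using (⌊log₂_⌋; ⌊log₂[2*b]⌋≡1+⌊log₂b⌋)
open import Data.Fin.Base using (zero; suc; punchIn)
open import Data.Fin.Properties using (_≟_; punchIn-injective; punchInᵢ≢i)
open import Data.Fin.Permutation using (Permutation′; _⟨$⟩ʳ_; id; insert; insert-punchIn)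
open import Data.Fin.Subset using (_∈_; ⁅_⁆; ⊤; ⊥; _∪_)
open import Data.Fin.Subset.Properties using (x∈⁅x⁆; ∈⊤; p⊆p∪q; ∪-identityˡ; ∪-identityʳ)
open import Algebra.Properties.CommutativeMonoid.Sum +-0-commutativeMonoid
  using (sum; sum-cong-≗; sum-permute)
open import Data.Product using (Σ; _×_; _,_; proj₁; proj₂)
open import Function.Base using (_∘_)
open import Function.Definitions using (Injective)
open import Relation.Nullary using (yes; no; contradiction)
open import Relation.Nullary.Decidable using (decidable-stable)
open import Relation.Binary.PropositionalEquality
  using (_≡_; _≢_; _≗_; refl; sym; trans; cong; subst; module ≡-Reasoning)

open ≡-Reasoning

parity : ℕ → Fin 2
parity zero          = zero
parity (suc zero)    = suc zero
parity (suc (suc m)) = parity m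

parity-suc : ∀ m → parity (suc m) ≢ parity m
parity-suc zero          ()
parity-suc (suc zero)    ()
parity-suc (suc (suc m)) = parity-suc m

log₂-parity : ℕ → Fin 2
log₂-parity y = parity ⌊log₂ y ⌋

log₂-parity-double : ∀ {y} → 1 ≤ y → log₂-parity (y + y) ≢ log₂-parity y
log₂-parity-double {y} 1≤y c[2y]≡c[y] = parity-suc ⌊log₂ y ⌋ (begin
  parity (suc ⌊log₂ y ⌋)  ≡⟨ cong parity (⌊log₂[2*b]⌋≡1+⌊log₂b⌋ y {{>-nonZero 1≤y}}) ⟨
  log₂-parity (2 * y)     ≡⟨ cong (log₂-parity ∘ (y +_)) (+-identityʳ y) ⟩
  log₂-parity (y + y)     ≡⟨ c[2y]≡c[y] ⟩
  log₂-parity y           ∎)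

finSum≡sum : ∀ {m} (f : Fin m → ℕ) → finSum f ≡ sum f
finSum≡sum {zero}  f = refl
finSum≡sum {suc m} f = cong (f zero +_) (finSum≡sum (f ∘ suc))

finSum-cong : ∀ {m} {f g : Fin m → ℕ} → f ≗ g → finSum f ≡ finSum g
finSum-cong {f = f} {g} f≗g = begin
  finSum f  ≡⟨ finSum≡sum f ⟩
  sum f     ≡⟨ sum-cong-≗ f≗g ⟩
  sum g     ≡⟨ finSum≡sum g ⟨
  finSum g  ∎

finSum-permute : ∀ {m} (f : Fin m → ℕ) (π : Permutation′ m) → finSum (f ∘ (π ⟨$⟩ʳ_)) ≡ finSum f
finSum-permute f π = begin
  finSum (f ∘ (π ⟨$⟩ʳ_))  ≡⟨ finSum≡sum (f ∘ (π ⟨$⟩ʳ_)) ⟩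
  sum (f ∘ (π ⟨$⟩ʳ_))     ≡⟨ sum-permute f π ⟨
  sum f                   ≡⟨ finSum≡sum f ⟨
  finSum f                ∎

subsetSum-⊥ : ∀ {m} (x : Fin m → ℕ) → subsetSum ⊥ x ≡ 0
subsetSum-⊥ {zero}  x = refl
subsetSum-⊥ {suc m} x = subsetSum-⊥ (x ∘ suc)

subsetSum-⊤ : ∀ {m} (x : Fin m → ℕ) → subsetSum ⊤ x ≡ finSum x
subsetSum-⊤ {zero}  x = refl
subsetSum-⊤ {suc m} x = cong (x zero +_) (subsetSum-⊤ (x ∘ suc))

subsetSum-⁅⁆ : ∀ {m} (a : Fin m) (x : Fin m → ℕ) → subsetSum ⁅ a ⁆ x ≡ x a
subsetSum-⁅⁆ zero    x = trans (cong (x zero +_) (subsetSum-⊥ (x ∘ suc))) (+-identityʳ (x zero))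
subsetSum-⁅⁆ (suc a) x = subsetSum-⁅⁆ a (x ∘ suc)

subsetSum-⁅⁆∪⁅⁆ : ∀ {m} {a b : Fin m} → a ≢ b → (x : Fin m → ℕ) →
  subsetSum (⁅ a ⁆ ∪ ⁅ b ⁆) x ≡ x a + x b
subsetSum-⁅⁆∪⁅⁆ {a = zero}  {zero}  a≢b x = contradiction refl a≢b
subsetSum-⁅⁆∪⁅⁆ {a = zero}  {suc b} a≢b x
  rewrite ∪-identityˡ ⁅ b ⁆ = cong (x zero +_) (subsetSum-⁅⁆ b (x ∘ suc))
subsetSum-⁅⁆∪⁅⁆ {a = suc a} {zero}  a≢b x
  rewrite ∪-identityʳ ⁅ a ⁆ = trans (cong (x zero +_) (subsetSum-⁅⁆ a (x ∘ suc))) (+-comm (x zero) (x (suc a)))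
subsetSum-⁅⁆∪⁅⁆ {a = suc a} {suc b} a≢b x = subsetSum-⁅⁆∪⁅⁆ (a≢b ∘ cong suc) (x ∘ suc)

module _ {m} {x : Fin m → ℕ} {F : Pred} (FS⊆F : FS⊆ x F) where

  FS⊆-singleton : ∀ a → F (x a)
  FS⊆-singleton a = subst F (subsetSum-⁅⁆ a x) (FS⊆F ⁅ a ⁆ (a , x∈⁅x⁆ a))

  FS⊆-injective : (∀ y → F y → ¬ F (y + y)) → Injective _≡_ _≡_ x
  FS⊆-injective no-doubles {a} {b} xa≡xb = decidable-stable (a ≟ b) λ a≢b →
    no-doubles (x a) (FS⊆-singleton a) (subst F (xa+xb≡2xa a≢b) (FS⊆F (⁅ a ⁆ ∪ ⁅ b ⁆) (a , a∈⁅a,b⁆)))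
    where
    a∈⁅a,b⁆ : a ∈ ⁅ a ⁆ ∪ ⁅ b ⁆
    a∈⁅a,b⁆ = p⊆p∪q ⁅ b ⁆ (x∈⁅x⁆ a)
    xa+xb≡2xa : a ≢ b → subsetSum (⁅ a ⁆ ∪ ⁅ b ⁆) x ≡ x a + x a
    xa+xb≡2xa a≢b = trans (subsetSum-⁅⁆∪⁅⁆ a≢b x) (cong (x a +_) (sym xa≡xb))

FS⊆-total : ∀ {m} {x : Fin (suc m) → ℕ} {F : Pred} → FS⊆ x F → F (finSum x)
FS⊆-total {x = x} {F} FS⊆F = subst F (subsetSum-⊤ x) (FS⊆F ⊤ (zero , ∈⊤))

¬¬-∀-Fin : ∀ {m} {P : Fin m → Set} → (∀ i → ¬ ¬ P i) → ¬ ¬ (∀ i → P i)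
¬¬-∀-Fin {zero}  _   ¬∀P = ¬∀P λ ()
¬¬-∀-Fin {suc m} ¬¬P ¬∀P = ¬¬P zero λ P₀ → ¬¬-∀-Fin (¬¬P ∘ suc) λ P₊ →
  ¬∀P λ { zero → P₀ ; (suc i) → P₊ i }

argmin : ∀ {m} (k : Fin (suc m) → ℕ) → Σ (Fin (suc m)) λ i → ∀ j → k i ≤ k j
argmin {zero}  k = zero , λ { zero → ≤-refl }
argmin {suc m} k with argmin (k ∘ suc)
... | i , k-min with k zero ≤? k (suc i)
...   | yes k₀≤kᵢ = zero , λ { zero → ≤-refl ; (suc j) → ≤-trans k₀≤kᵢ (k-min j) }
...   | no  k₀≰kᵢ = suc i , λ { zero → <⇒≤ (≰⇒> k₀≰kᵢ) ; (suc j) → k-min j }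

sortingPermutation : ∀ {m} (k : Fin m → ℕ) → Injective _≡_ _≡_ k →
  Σ (Permutation′ m) λ π → StrictlyIncreasing (k ∘ (π ⟨$⟩ʳ_))
sortingPermutation {zero}  k _     = id , λ ()
sortingPermutation {suc m} k k-inj with argmin k
... | i₀ , k-min with sortingPermutation (k ∘ punchIn i₀) (λ e → punchIn-injective i₀ _ _ (k-inj e))
...   | π , π-sorts = σ , σ-sorts
  where
  σ : Permutation′ (suc m)
  σ = insert zero i₀ π
  σ-suc : ∀ j → σ ⟨$⟩ʳ suc j ≡ punchIn i₀ (π ⟨$⟩ʳ j)
  σ-suc = insert-punchIn zero i₀ π
  σ-sorts : StrictlyIncreasing (k ∘ (σ ⟨$⟩ʳ_))
  σ-sorts zero    zero    ()
  σ-sorts zero    (suc j) _ rewrite σ-suc j =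
    ≤∧≢⇒< (k-min _) (λ e → punchInᵢ≢i i₀ _ (sym (k-inj e)))
  σ-sorts (suc i) zero    ()
  σ-sorts (suc i) (suc j) (s≤s i<j) rewrite σ-suc i | σ-suc j = π-sorts i j i<j

sortedIndices : ∀ {m} (s : ℕ → ℕ) (x : Fin m → ℕ) → Injective _≡_ _≡_ x → (∀ a → Range s (x a)) →
  Σ (Fin m → ℕ) λ k → StrictlyIncreasing k × finSum (s ∘ k) ≡ finSum x
sortedIndices s x x-inj x∈S = k ∘ (π ⟨$⟩ʳ_) , π-sorts , (begin
  finSum (s ∘ k ∘ (π ⟨$⟩ʳ_))  ≡⟨ finSum-permute (s ∘ k) π ⟩
  finSum (s ∘ k)              ≡⟨ finSum-cong (proj₂ ∘ x∈S) ⟩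
  finSum x                    ∎)
  where
  k : Fin _ → ℕ
  k = proj₁ ∘ x∈S
  k-inj : Injective _≡_ _≡_ k
  k-inj {a} {b} ka≡kb = x-inj (trans (sym (proj₂ (x∈S a))) (trans (cong s ka≡kb) (proj₂ (x∈S b))))
  π : Permutation′ _
  π = proj₁ (sortingPermutation k k-inj)
  π-sorts : StrictlyIncreasing (k ∘ (π ⟨$⟩ʳ_))
  π-sorts = proj₂ (sortingPermutation k k-inj)

lemma3p5 : (n : ℕ) → 2 ≤ n →
    (s : ℕ → ℕ) → (∀ i → 1 ≤ s i) → (∀ i j → i < j → s i < s j) →
    ((k : Fin n → ℕ) → StrictlyIncreasing k →
      ¬ Range s (finSum (λ i → s (k i)))) →
    IP* n (Compl (Range s))
lemma3p5 (suc n) (s≤s _) s _ _ no-sum-in-S A A⊆𝐍 IP-A A∩[𝐍∖S]≡∅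
  with IP-A 2 (λ y _ → log₂-parity y)
... | j , x , _ , FS⊆cell =
  ¬¬-∀-Fin (λ a → A⊆S (x a) (proj₁ (FS⊆-singleton {F = cell} FS⊆cell a))) λ x∈S →
  A⊆S (finSum x) (proj₁ (FS⊆-total {F = cell} FS⊆cell)) λ Σx∈S →
  let k , k-sorted , Σsk≡Σx = sortedIndices s x (FS⊆-injective {F = cell} FS⊆cell no-doubles) x∈S
  in  no-sum-in-S k k-sorted (subst (Range s) (sym Σsk≡Σx) Σx∈S)
  where
  A⊆S : ∀ y → A y → ¬ ¬ Range s y
  A⊆S y y∈A y∉S = A∩[𝐍∖S]≡∅ y (A⊆𝐍 y y∈A , y∉S) y∈A
  cell : Pred
  cell y = Σ (A y) λ _ → log₂-parity y ≡ j
  no-doubles : ∀ y → cell y → ¬ cell (y + y)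
  no-doubles y (y∈A , cy≡j) (_ , c2y≡j) = log₂-parity-double (A⊆𝐍 y y∈A) (trans c2y≡j (sym cy≡j))
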